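{- Let $q \ge 2$ be an integer and let $a_2, \dots, a_q$ be integers with $a_i \ge 1$ for $2 \le i \le q$ and $a_q \ge 2$. Let $r$ be a positive integer, and put $k = 1 + rq$, $c = 2 + (r-1)q$. Let $\{G_n\}_{n \ge 1}$ be defined by $G_1 = 1$, $G_i = 0$ for $2 \le i \le k$, and for $n > k$ $$G_n = G_{n-k} - \left(a_2 G_{n-k+1} + \cdots + a_q G_{n-k+q-1}\right) - \left(G_{n-k+q} + \cdots + G_{n-1}\right).$$ Set $R_{t,s} = G_{k+(t-1)c+s}$ for $1 \le t \le r$, $1 \le s \le c$. For each $t$, let $l(t)$ be the largest $s \in \{1, \dots, c\}$ with $R_{t,s} \neq 0$. Then $l(1), \dots, l(r)$ is an arithmetic progression with common difference $q$: $$\langle l(1), l(2), \dots, l(r) \rangle = \langle 2, 2+q, 2+2q, \dots, 2+(r-1)q = c \rangle.$$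
   Context: $R_{t,s}$ is the $r\times c$ rectangle formed by writing $G_{k+1},\dots,G_{k+rc}$ row by row, with $c$ entries per row. The recursion is the one whose characteristic polynomial, with leading coefficient $-1$, is the degree-$k$ Taylor polynomial of $2-\frac{1}{1-X}-\sum_{i=2}^q(a_i-1)X^{i-1}$. -}

module Defs where

open import Data.Nat using (ℕ; zero; suc; _∸_; _<_; _≤_)
import Data.Nat as N
open import Data.Integer using (ℤ; _+_; _-_; _*_; 0ℤ; 1ℤ)
open import Data.Bool using (if_then_else_)
open import Relation.Nullary.Decidable using (⌊_⌋)
open import Data.Product using (_×_)
open import Relation.Binary.PropositionalEquality using (_≡_; _≢_)

sumFrom : ℕ → ℕ → (ℕ → ℤ) → ℤ
sumFrom lo zero f = 0ℤ
sumFrom lo (suc len) f = f lo + sumFrom (suc lo) len f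

sumRange : ℕ → ℕ → (ℕ → ℤ) → ℤ
sumRange lo hi f = sumFrom lo (suc hi ∸ lo) f

-- A window is the function i ↦ G_{n+i}, meaningful for 1 ≤ i ≤ k.
Window : Set
Window = ℕ → ℤ

initWindow : Window
initWindow 1 = 1ℤ
initWindow _ = 0ℤ

nextTerm : (q k : ℕ) (a : ℕ → ℤ) → Window → ℤ
nextTerm q k a w = w 1 - sumRange 2 q (λ i → a i * w i) - sumRange (suc q) k w

step : (q k : ℕ) (a : ℕ → ℤ) → Window → Window
step q k a w i = if ⌊ i N.≟ k ⌋ then nextTerm q k a w else w (suc i)

windowAt : (q k : ℕ) (a : ℕ → ℤ) → ℕ → Window
windowAt q k a zero = initWindow
windowAt q k a (suc n) = step q k a (windowAt q k a n)

-- G n = G_n for n ≥ 1 (G 0 is a junk value 0).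
G : (q k : ℕ) (a : ℕ → ℤ) → ℕ → ℤ
G q k a zero = 0ℤ
G q k a (suc n) = windowAt q k a n 1

IsLargestNonzero : (c : ℕ) (f : ℕ → ℤ) (l : ℕ) → Set
IsLargestNonzero c f l =
  (1 ≤ l × l ≤ c) × (f l ≢ 0ℤ) × (∀ s → l < s → s ≤ c → f s ≡ 0ℤ)

{-# OPTIONS --safe #-}
-- If G vanishes at n+2, …, n+q+1, the weighted terms a_i G drop out of the recurrence at
-- steps n and n+1, while the tail sum G_{n+q+1} + … + G_{n+k} slides by one place, losing a
-- zero and gaining G_{n+k+1}.  Together this gives G_{n+k+2} = −G_{n+1}.  Since c + q = k + 1,
-- in the rectangle this reads R_{t+1,s+q+1} = −R_{t,s+1} whenever row t vanishes at
-- s+2, …, s+q+1: past its last nonzero entry, each row is the previous one negated and shifted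
-- right by q.  The zero initial values make row 1 equal to (1, −1, 0, …, 0), so the last nonzero
-- entry of row t is ±1 at position 2 + (t−1)q.
module Submission where

open import Defs
open import Data.Nat using (ℕ; zero; suc; _+_; _*_; _∸_; _≤_; _<_; z≤n; s≤s; z<s; _≤?_; _≟_)
open import Data.Nat.Properties
open import Data.Integer using (ℤ; +_; 0ℤ; -_; _-_; ∣_∣) renaming (_+_ to _+ℤ_; _*_ to _*ℤ_)
import Data.Integer.Properties as ℤ
open import Data.List using ([]; _∷_)
open import Data.Product using (_×_; _,_; proj₁; proj₂)
open import Relation.Nullary using (yes; no; contradiction)
open import Relation.Binary.PropositionalEquality
import Data.Nat.Tactic.RingSolver as ℕ-Solver
import Data.Integer.Tactic.RingSolver as ℤ-Solver
open ≡-Reasoning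

sumFrom-cong : ∀ lo len {f g : ℕ → ℤ} → (∀ j → lo ≤ j → j < lo + len → f j ≡ g j) →
  sumFrom lo len f ≡ sumFrom lo len g
sumFrom-cong lo zero      f≗g = refl
sumFrom-cong lo (suc len) f≗g = cong₂ _+ℤ_
  (f≗g lo ≤-refl (subst (lo <_) (sym (+-suc lo len)) (m≤m+n (suc lo) len)))
  (sumFrom-cong (suc lo) len λ j lo<j j<end →
    f≗g j (<⇒≤ lo<j) (subst (j <_) (sym (+-suc lo len)) j<end))

sumFrom-const-0 : ∀ lo len → sumFrom lo len (λ _ → 0ℤ) ≡ 0ℤ
sumFrom-const-0 lo zero      = refl
sumFrom-const-0 lo (suc len) = trans (ℤ.+-identityˡ _) (sumFrom-const-0 (suc lo) len)

sumFrom-∘suc : ∀ lo len (f : ℕ → ℤ) → sumFrom lo len (λ j → f (suc j)) ≡ sumFrom (suc lo) len f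
sumFrom-∘suc lo zero      f = refl
sumFrom-∘suc lo (suc len) f = cong (f (suc lo) +ℤ_) (sumFrom-∘suc (suc lo) len f)

sumFrom-snoc : ∀ lo len (f : ℕ → ℤ) → sumFrom lo (suc len) f ≡ sumFrom lo len f +ℤ f (lo + len)
sumFrom-snoc lo zero      f = begin
  f lo +ℤ 0ℤ      ≡⟨ ℤ.+-comm (f lo) 0ℤ ⟩
  0ℤ +ℤ f lo      ≡⟨ cong (λ m → 0ℤ +ℤ f m) (sym (+-identityʳ lo)) ⟩
  0ℤ +ℤ f (lo + 0) ∎
sumFrom-snoc lo (suc len) f = begin
  f lo +ℤ sumFrom (suc lo) (suc len) f                    ≡⟨ cong (f lo +ℤ_) (sumFrom-snoc (suc lo) len f) ⟩
  f lo +ℤ (sumFrom (suc lo) len f +ℤ f (suc lo + len))  ≡⟨ sym (ℤ.+-assoc (f lo) _ _) ⟩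
  f lo +ℤ sumFrom (suc lo) len f +ℤ f (suc lo + len)    ≡⟨ cong (λ m → sumFrom lo (suc len) f +ℤ f m) (sym (+-suc lo len)) ⟩
  sumFrom lo (suc len) f +ℤ f (lo + suc len)            ∎

in-range : ∀ {lo hi j} → lo ≤ j → j < lo + (suc hi ∸ lo) → j ≤ hi
in-range {lo} {hi} {j} lo≤j j<end with lo ≤? suc hi
... | yes lo≤1+hi = ≤-pred (subst (j <_) (m+[n∸m]≡n lo≤1+hi) j<end)
... | no  lo≰1+hi = contradiction (≤-trans j<end (≤-reflexive (begin
  lo + (suc hi ∸ lo) ≡⟨ cong (λ m → lo + m) (m≤n⇒m∸n≡0 (<⇒≤ (≰⇒> lo≰1+hi))) ⟩
  lo + 0             ≡⟨ +-identityʳ lo ⟩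
  lo                 ∎))) (≤⇒≯ lo≤j)

sumRange-cong : ∀ lo hi {f g : ℕ → ℤ} → (∀ j → lo ≤ j → j ≤ hi → f j ≡ g j) →
  sumRange lo hi f ≡ sumRange lo hi g
sumRange-cong lo hi f≗g = sumFrom-cong lo (suc hi ∸ lo) λ j lo≤j j<end → f≗g j lo≤j (in-range lo≤j j<end)

sumRange-zero : ∀ lo hi {f : ℕ → ℤ} → (∀ j → lo ≤ j → j ≤ hi → f j ≡ 0ℤ) → sumRange lo hi f ≡ 0ℤ
sumRange-zero lo hi f≗0 = trans (sumRange-cong lo hi f≗0) (sumFrom-const-0 lo (suc hi ∸ lo))

sumRange-∘suc : ∀ {lo hi} (f : ℕ → ℤ) → lo ≤ suc hi →
  sumRange lo hi (λ j → f (suc j)) +ℤ f lo ≡ sumRange lo hi f +ℤ f (suc hi)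
sumRange-∘suc {lo} {hi} f lo≤1+hi = begin
  sumFrom lo len (λ j → f (suc j)) +ℤ f lo ≡⟨ cong (_+ℤ f lo) (sumFrom-∘suc lo len f) ⟩
  sumFrom (suc lo) len f +ℤ f lo           ≡⟨ ℤ.+-comm _ (f lo) ⟩
  sumFrom lo (suc len) f                   ≡⟨ sumFrom-snoc lo len f ⟩
  sumFrom lo len f +ℤ f (lo + len)         ≡⟨ cong (λ m → sumFrom lo len f +ℤ f m) (m+[n∸m]≡n lo≤1+hi) ⟩
  sumFrom lo len f +ℤ f (suc hi)           ∎
  where len = suc hi ∸ lo

Recurrent : (q k : ℕ) (a : ℕ → ℤ) → (ℕ → ℤ) → Set
Recurrent q k a f = ∀ n →
  f (suc n + k) ≡ f (suc n) - sumRange 2 q (λ i → a i *ℤ f (n + i)) - sumRange (suc q) k (λ j → f (n + j))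

m+[n-m]≡n : ∀ m n → m +ℤ (n - m) ≡ n
m+[n-m]≡n = ℤ-Solver.solve-∀

recurrent-antiperiodic : ∀ {q k a f} → 1 ≤ q → q ≤ k → Recurrent q k a f →
  ∀ n → (∀ i → 2 ≤ i → i ≤ suc q → f (n + i) ≡ 0ℤ) → f (suc (suc n) + k) ≡ - f (suc n)
recurrent-antiperiodic {q} {k} {a} {f} 1≤q q≤k rec n vanish = begin
  f (suc (suc n) + k)                              ≡⟨ rec (suc n) ⟩
  f (suc (suc n)) - weights (suc n) - tail (suc n) ≡⟨ cong₂ _-_ (cong₂ _-_ f[n+2]≡0 weights[n+1]≡0) tail[n+1]≡f[n+1] ⟩
  0ℤ - f (suc n)                                   ≡⟨ ℤ.+-identityˡ (- f (suc n)) ⟩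
  - f (suc n)                                      ∎
  where
  weights tail : ℕ → ℤ
  weights m = sumRange 2 q (λ i → a i *ℤ f (m + i))
  tail    m = sumRange (suc q) k (λ j → f (m + j))

  f[n+2]≡0 : f (suc (suc n)) ≡ 0ℤ
  f[n+2]≡0 = trans (cong f (+-comm 2 n)) (vanish 2 ≤-refl (s≤s 1≤q))

  weights≡0 : ∀ m → (∀ i → 2 ≤ i → i ≤ q → f (m + i) ≡ 0ℤ) → weights m ≡ 0ℤ
  weights≡0 m f≡0 = sumRange-zero 2 q λ i 2≤i i≤q → trans (cong (a i *ℤ_) (f≡0 i 2≤i i≤q)) (ℤ.*-zeroʳ (a i))

  weights[n+1]≡0 : weights (suc n) ≡ 0ℤ
  weights[n+1]≡0 = weights≡0 (suc n) λ i 2≤i i≤q →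
    trans (cong f (sym (+-suc n i))) (vanish (suc i) (m≤n⇒m≤1+n 2≤i) (s≤s i≤q))

  f[n+k+1]≡f[n+1]-tail[n] : f (suc n + k) ≡ f (suc n) - tail n
  f[n+k+1]≡f[n+1]-tail[n] = begin
    f (suc n + k)                        ≡⟨ rec n ⟩
    f (suc n) - weights n - tail n       ≡⟨ cong (λ w → f (suc n) - w - tail n) (weights≡0 n λ i 2≤i i≤q → vanish i 2≤i (m≤n⇒m≤1+n i≤q)) ⟩
    f (suc n) - 0ℤ - tail n              ≡⟨ cong (_- tail n) (ℤ.+-identityʳ (f (suc n))) ⟩
    f (suc n) - tail n                   ∎

  tail[n+1]≡f[n+1] : tail (suc n) ≡ f (suc n)
  tail[n+1]≡f[n+1] = begin
    tail (suc n)                                               ≡⟨ sym (ℤ.+-identityʳ _) ⟩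
    tail (suc n) +ℤ 0ℤ                                         ≡⟨ cong₂ _+ℤ_ (sumRange-cong (suc q) k λ j _ _ → cong f (sym (+-suc n j)))
                                                                              (sym (vanish (suc q) (s≤s 1≤q) ≤-refl)) ⟩
    sumRange (suc q) k (λ j → f (n + suc j)) +ℤ f (n + suc q) ≡⟨ sumRange-∘suc (λ j → f (n + j)) (s≤s q≤k) ⟩
    tail n +ℤ f (n + suc k)                                    ≡⟨ cong (λ m → tail n +ℤ f m) (+-suc n k) ⟩
    tail n +ℤ f (suc n + k)                                    ≡⟨ cong (tail n +ℤ_) f[n+k+1]≡f[n+1]-tail[n] ⟩
    tail n +ℤ (f (suc n) - tail n)                             ≡⟨ m+[n-m]≡n (tail n) (f (suc n)) ⟩
    f (suc n)                                                  ∎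

module _ (q k : ℕ) (a : ℕ → ℤ) where
  private
    W : ℕ → Window
    W = windowAt q k a

  window-step-below : ∀ n {i} → i < k → W (suc n) i ≡ W n (suc i)
  window-step-below n {i} i<k with i ≟ k
  ... | yes i≡k = contradiction i≡k (<⇒≢ i<k)
  ... | no  _   = refl

  window-step-top : ∀ n → W (suc n) k ≡ nextTerm q k a (W n)
  window-step-top n with k ≟ k
  ... | yes _   = refl
  ... | no  k≢k = contradiction refl k≢k

  window-shift : ∀ n j i → i + j ≤ k → W (n + j) i ≡ W n (i + j)
  window-shift n zero    i _       = cong₂ W (+-identityʳ n) (sym (+-identityʳ i))
  window-shift n (suc j) i i+j≤k = begin
    W (n + suc j) i   ≡⟨ cong (λ m → W m i) (+-suc n j) ⟩
    W (suc (n + j)) i ≡⟨ window-step-below (n + j) (<-≤-trans (m<m+n i z<s) i+j≤k) ⟩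
    W (n + j) (suc i) ≡⟨ window-shift n j (suc i) (subst (_≤ k) (+-suc i j) i+j≤k) ⟩
    W n (suc i + j)   ≡⟨ cong (W n) (sym (+-suc i j)) ⟩
    W n (i + suc j)   ∎

  window≡G : ∀ n i → 1 ≤ i → i ≤ k → W n i ≡ G q k a (n + i)
  window≡G n (suc i) _ i≤k = trans (sym (window-shift n i 1 i≤k)) (cong (G q k a) (sym (+-suc n i)))

  G-initial : ∀ i → 2 ≤ i → i ≤ k → G q k a i ≡ 0ℤ
  G-initial (suc (suc i)) _ i≤k = window-shift 0 (suc i) 1 i≤k
  G-initial 1 (s≤s ()) _

  G-recurrent : 1 ≤ k → q ≤ k → Recurrent q k a (G q k a)
  G-recurrent 1≤k q≤k n = begin
    W (n + k) 1                      ≡⟨ cong (λ m → W m 1) (trans (cong (λ m → n + m) (sym 1+[k-1]≡k)) (+-suc n (k ∸ 1))) ⟩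
    W (suc n + (k ∸ 1)) 1            ≡⟨ window-shift (suc n) (k ∸ 1) 1 (≤-reflexive 1+[k-1]≡k) ⟩
    W (suc n) (1 + (k ∸ 1))          ≡⟨ cong (W (suc n)) 1+[k-1]≡k ⟩
    W (suc n) k                      ≡⟨ window-step-top n ⟩
    nextTerm q k a (W n)             ≡⟨ cong₂ (λ s t → W n 1 - s - t)
                                          (sumRange-cong 2 q λ i 2≤i i≤q → cong (a i *ℤ_) (window≡G n i (<⇒≤ 2≤i) (≤-trans i≤q q≤k)))
                                          (sumRange-cong (suc q) k λ j q<j j≤k → window≡G n j (≤-trans (s≤s z≤n) q<j) j≤k) ⟩
    G q k a (suc n) - sumRange 2 q (λ i → a i *ℤ G q k a (n + i)) - sumRange (suc q) k (λ j → G q k a (n + j)) ∎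
    where
    1+[k-1]≡k : 1 + (k ∸ 1) ≡ k
    1+[k-1]≡k = m+[n∸m]≡n 1≤k

row-index : ∀ p q T s → let k = 1 + suc p * q; c = 2 + p * q in
  k + suc T * c + (q + suc s) ≡ suc (suc (k + T * c + s)) + k
row-index = ℕ-Solver.solve-∀

module Rows (q : ℕ) (1≤q : 1 ≤ q) (a : ℕ → ℤ) (p : ℕ) where
  k c : ℕ
  k = 1 + suc p * q
  c = 2 + p * q

  -- rows are counted from 0: R T s is the paper's R_{T+1,s}
  R : ℕ → ℕ → ℤ
  R T s = G q k a (k + T * c + s)

  q≤k : q ≤ k
  q≤k = m≤n⇒m≤1+n (m≤m+n q (p * q))

  2+pq≤k : 2 + p * q ≤ k
  2+pq≤k = s≤s (+-monoˡ-≤ (p * q) 1≤q)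

  antiperiodic : ∀ n → (∀ i → 2 ≤ i → i ≤ suc q → G q k a (n + i) ≡ 0ℤ) →
    G q k a (suc (suc n) + k) ≡ - G q k a (suc n)
  antiperiodic = recurrent-antiperiodic {a = a} {f = G q k a} 1≤q q≤k (G-recurrent q k a (s≤s z≤n) q≤k)

  first-row : ∀ n → n ≤ p * q → R 0 (2 + n) ≡ - G q k a (suc n)
  first-row n n≤pq = trans (cong (G q k a) (trans (cong (_+ (2 + n)) (+-identityʳ k)) (+-comm k (2 + n))))
                           (antiperiodic n vanish)
    where
    vanish : ∀ i → 2 ≤ i → i ≤ suc q → G q k a (n + i) ≡ 0ℤ
    vanish i 2≤i i≤1+q = G-initial q k a (n + i) (≤-trans 2≤i (m≤n+m i n))
      (≤-trans (+-mono-≤ n≤pq i≤1+q) (≤-reflexive (trans (+-suc (p * q) q) (cong suc (+-comm (p * q) q)))))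

  next-row : ∀ T s → (∀ i → 2 ≤ i → i ≤ suc q → R T (s + i) ≡ 0ℤ) → R (suc T) (q + suc s) ≡ - R T (suc s)
  next-row T s vanish = begin
    G q k a (k + suc T * c + (q + suc s))  ≡⟨ cong (G q k a) (row-index p q T s) ⟩
    G q k a (suc (suc (k + T * c + s)) + k) ≡⟨ antiperiodic (k + T * c + s) (λ i 2≤i i≤1+q →
                                                trans (cong (G q k a) (+-assoc (k + T * c) s i)) (vanish i 2≤i i≤1+q)) ⟩
    - G q k a (suc (k + T * c + s))         ≡⟨ cong (λ m → - G q k a m) (sym (+-suc (k + T * c) s)) ⟩
    - R T (suc s)                           ∎

  VanishesPastLead : ℕ → Set
  VanishesPastLead T = ∀ x → 2 + T * q < x → x ≤ c → R T x ≡ 0ℤ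

  UnitLead : ℕ → Set
  UnitLead T = ∣ R T (2 + T * q) ∣ ≡ 1

  next-row-past-lead : ∀ T → VanishesPastLead T → ∀ s → T * q < s → q + suc s ≤ c → R (suc T) (q + suc s) ≡ - R T (suc s)
  next-row-past-lead T tail s Tq<s q+1+s≤c = next-row T s λ i 2≤i i≤1+q → tail (s + i)
    (subst (_≤ s + i) (+-comm (suc (T * q)) 2) (+-mono-≤ Tq<s 2≤i))
    (≤-trans (+-monoʳ-≤ s i≤1+q) (subst (_≤ c) (sym (trans (+-comm s (suc q)) (sym (+-suc q s)))) q+1+s≤c))

  row-shape : ∀ T → T ≤ p → VanishesPastLead T × UnitLead T
  row-shape zero _ = tail₀ , cong ∣_∣ (first-row 0 z≤n)
    where
    tail₀ : VanishesPastLead 0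
    tail₀ (suc (suc (suc m))) (s≤s (s≤s (s≤s _))) x≤c = begin
      R 0 (2 + suc m)          ≡⟨ first-row (suc m) (≤-pred (≤-pred x≤c)) ⟩
      - G q k a (suc (suc m))  ≡⟨ cong -_ (G-initial q k a (suc (suc m)) (s≤s (s≤s z≤n)) (≤-trans (n≤1+n _) (≤-trans x≤c 2+pq≤k))) ⟩
      0ℤ                       ∎
  row-shape (suc T) 1+T≤p with tail , lead ← row-shape T (<⇒≤ 1+T≤p) = tail′ , lead′
    where
    tail′ : VanishesPastLead (suc T)
    tail′ x lt x≤c with d , x≡ ← m≤n⇒∃[o]m+o≡n lt = subst (λ y → R (suc T) y ≡ 0ℤ) q+1+s≡x (begin
      R (suc T) (q + suc s) ≡⟨ next-row-past-lead T tail s (s≤s (≤-trans (m≤m+n (T * q) d) (n≤1+n _))) (subst (_≤ c) (sym q+1+s≡x) x≤c) ⟩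
      - R T (suc s)         ≡⟨ cong -_ (tail (suc s) (s≤s (s≤s (s≤s (m≤m+n (T * q) d)))) (≤-trans (m≤n+m (suc s) q) (subst (_≤ c) (sym q+1+s≡x) x≤c))) ⟩
      0ℤ                    ∎)
      where
      s : ℕ
      s = 2 + T * q + d
      q+1+s≡x : q + suc s ≡ x
      q+1+s≡x = trans reorder x≡
        where
        reorder : q + suc (2 + T * q + d) ≡ 3 + suc T * q + d
        reorder = ℕ-Solver.solve (q ∷ T ∷ d ∷ [])

    lead′ : UnitLead (suc T)
    lead′ = begin
      ∣ R (suc T) (2 + suc T * q) ∣        ≡⟨ cong (λ y → ∣ R (suc T) y ∣) 2+[1+T]q≡q+[2+Tq] ⟩
      ∣ R (suc T) (q + suc (1 + T * q)) ∣  ≡⟨ cong ∣_∣ (next-row-past-lead T tail (1 + T * q) ≤-refl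
                                               (subst (_≤ c) 2+[1+T]q≡q+[2+Tq] (s≤s (s≤s (*-monoˡ-≤ q 1+T≤p))))) ⟩
      ∣ - R T (2 + T * q) ∣                ≡⟨ ℤ.∣-i∣≡∣i∣ (R T (2 + T * q)) ⟩
      ∣ R T (2 + T * q) ∣                  ≡⟨ lead ⟩
      1                                    ∎
      where
      2+[1+T]q≡q+[2+Tq] : 2 + suc T * q ≡ q + suc (1 + T * q)
      2+[1+T]q≡q+[2+Tq] = sym (trans (+-suc q _) (cong suc (+-suc q _)))

corollary5p2 : (q : ℕ) → 2 ≤ q → (a : ℕ → ℤ) →
    (∀ i → 2 ≤ i → i ≤ q → + 1 Data.Integer.≤ a i) → + 2 Data.Integer.≤ a q →
    (r : ℕ) → 1 ≤ r →
    let k = 1 + r * q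
        c = 2 + (r ∸ 1) * q
        R = λ t s → G q k a (k + (t ∸ 1) * c + s)
    in ∀ t → 1 ≤ t → t ≤ r → IsLargestNonzero c (R t) (2 + (t ∸ 1) * q)
corollary5p2 q 2≤q a _ _ (suc p) _ (suc T) _ (s≤s T≤p) =
  (s≤s z≤n , s≤s (s≤s (*-monoˡ-≤ q T≤p))) , lead≢0 , proj₁ (row-shape T T≤p)
  where
  open Rows q (≤-trans (n≤1+n 1) 2≤q) a p
  lead≢0 : R T (2 + T * q) ≢ 0ℤ
  lead≢0 R≡0 = contradiction (trans (sym (proj₂ (row-shape T T≤p))) (cong ∣_∣ R≡0)) λ ()
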